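{- Let $j\ge1$ and $S\subseteq\{0,1,\dots,j\}$, and let $R_S\subseteq\{0,1\}^j$ be the relation consisting of all tuples with exactly $s$ ones for some $s\in S$. Then: (1) $R_S$ is bijunctive iff $S=\{0,\dots,j\}$, or $S\subseteq\{0,j\}$, or $S=\{0,1\}$, or $S=\{j-1,j\}$, or $j\le2$. (2) $R_S$ is affine iff $S=\{0,\dots,j\}$, or $S\subseteq\{0,j\}$, or $S$ is the set of all even numbers in $\{0,\dots,j\}$, or $S$ is the set of all odd numbers in $\{0,\dots,j\}$. (3) For $S=\{i\}$, $R_S$ is bijunctive iff $(i,j)$ has $i=0$, or $i=j$, or $(i,j)=(1,2)$. (4) For $S=\{i\}$, $R_S$ is affine iff $i=0$, or $i=j$, or $(i,j)=(1,2)$.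
   Context: A relation $R\subseteq\{0,1\}^j$ is bijunctive if for any three tuples in $R$ their bitwise majority lies in $R$, and affine if for any three tuples in $R$ their bitwise XOR lies in $R$. -}

module Defs where

open import Data.Bool using (Bool; true; false; _∧_; _∨_; _xor_)
open import Data.Nat using (ℕ; zero; suc; _≤_)
open import Data.Nat.Properties using ()
open import Data.Fin using (Fin; toℕ)
open import Data.Fin.Subset using (Subset; _∈_)
open import Data.Vec using (Vec; []; _∷_; zipWith; count)
open import Data.Bool.Properties using (T?)
open import Data.Product using (∃; _×_)
open import Relation.Binary.PropositionalEquality using (_≡_)
open import Data.Nat using (_%_)

BoolRel : ℕ → Set₁
BoolRel j = Vec Bool j → Set

maj : Bool → Bool → Bool → Bool
maj x y z = (x ∧ y) ∨ ((y ∧ z) ∨ (x ∧ z))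

majVec : ∀ {j} → Vec Bool j → Vec Bool j → Vec Bool j → Vec Bool j
majVec [] [] [] = []
majVec (x ∷ xs) (y ∷ ys) (z ∷ zs) = maj x y z ∷ majVec xs ys zs

xor3Vec : ∀ {j} → Vec Bool j → Vec Bool j → Vec Bool j → Vec Bool j
xor3Vec xs ys zs = zipWith _xor_ (zipWith _xor_ xs ys) zs

Bijunctive : ∀ {j} → BoolRel j → Set
Bijunctive R = ∀ t u v → R t → R u → R v → R (majVec t u v)

Affine : ∀ {j} → BoolRel j → Set
Affine R = ∀ t u v → R t → R u → R v → R (xor3Vec t u v)

ones : ∀ {j} → Vec Bool j → ℕ
ones t = count T? t

R[_] : ∀ {j} → Subset (suc j) → BoolRel j
R[_] {j} S t = ∃ λ (s : Fin (suc j)) → s ∈ S × toℕ s ≡ ones t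

IsEven : ℕ → Set
IsEven n = n % 2 ≡ 0

IsOdd : ℕ → Set
IsOdd n = n % 2 ≡ 1

{-# OPTIONS --safe #-}
module Submission where

-- Since R_S is invariant under permuting coordinates, closure of R_S under majority or under
-- x ⊕ y ⊕ z is a property of the weight set S alone.  Padding three short tuples with common
-- blocks of equal bits shows how weights propagate.  Under majority a weight w with
-- 2 ≤ w ≤ j - 2 spreads one step at a time to all of {0, …, j}, and for j ≥ 3 the remaining
-- sets are pinned down by whether 1 and j - 1 are weights.  Under x ⊕ y ⊕ z a weight strictly
-- between 0 and j spreads over its whole parity class, and a weight of the other parity then
-- spreads over the other class.  Conversely: constant tuples are closed under both operations;
-- 2 |maj(t,u,v)| ≤ |t| + |u| + |v| keeps weights ≤ 1, and complementation turns this into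
-- weights ≥ j - 1; |t ⊕ u ⊕ v| ≡ |t| + |u| + |v| (mod 2) keeps a parity class; and for j ≤ 2
-- the majority of three tuples is always one of them.

open import Defs
import Algebra.Properties.CommutativeSemigroup as CommutativeSemigroupProperties
open import Data.Bool using (Bool; true; false; not; _xor_; if_then_else_)
open import Data.Bool.Properties using (T?)
open import Data.Empty using (⊥-elim)
open import Data.Fin using (Fin; zero; suc; toℕ; fromℕ<)
open import Data.Fin.Properties using (toℕ-injective; toℕ-fromℕ<; toℕ≤pred[n]; any?)
open import Data.Fin.Subset using (Subset; _∈_; ⁅_⁆)
open import Data.Fin.Subset.Properties using (_∈?_; x∈⁅x⁆; x∈⁅y⁆⇒x≡y)
open import Data.Nat
  using (ℕ; zero; suc; pred; parity; _+_; _*_; _∸_; _≤_; _<_; z≤n; s≤s; _≟_; _≤?_)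
open import Data.Nat.Properties
  using (≤-refl; ≤-trans; ≤-total; ≤-pred; <⇒≤; pred[n]≤n; 1+n≰n; n≤1+n; m≤n+m;
         m≤n⇒m<n∨m≡n; m≤n⇒∃[o]m+o≡n; n≤1⇒n≡0∨n≡1; +-assoc; +-comm; +-identityʳ; +-suc;
         +-cancelˡ-≡; +-mono-≤; *-identityʳ; *-distribˡ-+; *-cancelˡ-<; m≢1+m+n; m+n∸n≡m;
         module ≤-Reasoning)
open import Data.Nat.Tactic.RingSolver using (solve-∀)
open import Data.Parity.Base using (Parity; 0ℙ; 1ℙ) renaming (_+_ to _+ℙ_)
open import Data.Parity.Properties using (+-homo-+; p+p≡0ℙ; p≢p⁻¹)
  renaming (_≟_ to _ℙ≟_; +-cancelˡ-≡ to +ℙ-cancelˡ-≡; +-identityʳ to +ℙ-identityʳ;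
            +-commutativeSemigroup to +ℙ-commutativeSemigroup)
open import Data.Product using (_×_; _,_; ∃-syntax)
open import Data.Sum using (_⊎_; inj₁; inj₂; map₂) renaming (map to map-⊎)
open import Data.Vec using (Vec; []; _∷_; _++_; replicate; map; zipWith)
open import Data.Vec.Properties using (count≤n)
open import Function.Base using (_∘_)
open import Function.Bundles using (_⇔_; mk⇔; Equivalence)
open import Function.Construct.Composition using (_⇔-∘_)
open import Function.Construct.Symmetry using (⇔-sym)
open import Relation.Binary.PropositionalEquality
  using (_≡_; _≢_; refl; sym; trans; cong; cong₂; subst; module ≡-Reasoning)
open import Relation.Nullary using (Dec; yes; no; ¬?)
open import Relation.Nullary.Decidable using (_×-dec_)

open Equivalence using (to; from)

infix 4 _∈ₙ_

-- R[ S ] t unfolds to ones t ∈ₙ S.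
_∈ₙ_ : ∀ {j} → ℕ → Subset (suc j) → Set
n ∈ₙ S = ∃[ s ] s ∈ S × toℕ s ≡ n

_∈ₙ?_ : ∀ {j} n (S : Subset (suc j)) → Dec (n ∈ₙ S)
n ∈ₙ? S = any? (λ s → (s ∈? S) ×-dec (toℕ s ≟ n))

∈⇒∈ₙ : ∀ {j} {S : Subset (suc j)} {s} → s ∈ S → toℕ s ∈ₙ S
∈⇒∈ₙ s∈S = _ , s∈S , refl

∈ₙ⇒∈ : ∀ {j} {S : Subset (suc j)} {s} → toℕ s ∈ₙ S → s ∈ S
∈ₙ⇒∈ {S = S} (s′ , s′∈S , eq) = subst (_∈ S) (toℕ-injective eq) s′∈S

∈ₙ⇒≤ : ∀ {j} {S : Subset (suc j)} {n} → n ∈ₙ S → n ≤ j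
∈ₙ⇒≤ (s , _ , refl) = toℕ≤pred[n] s

∈⇔-from-weights : ∀ {j} {S : Subset (suc j)} {Q : ℕ → Set} →
                  (∀ {n} → n ∈ₙ S → Q n) → (∀ {n} → n ≤ j → Q n → n ∈ₙ S) →
                  ∀ s → s ∈ S ⇔ Q (toℕ s)
∈⇔-from-weights sound complete s =
  mk⇔ (λ s∈S → sound (∈⇒∈ₙ s∈S)) (λ q → ∈ₙ⇒∈ (complete (toℕ≤pred[n] s) q))

∈ₙ⇔-from-∈⇔ : ∀ {j} {S : Subset (suc j)} {Q : ℕ → Set} → (∀ s → s ∈ S ⇔ Q (toℕ s)) →
              ∀ {n} → n ≤ j → n ∈ₙ S ⇔ Q n
∈ₙ⇔-from-∈⇔ {Q = Q} spec n≤j = mk⇔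
  (λ { (s , s∈S , refl) → to (spec s) s∈S })
  (λ q → _ , from (spec _) (subst Q (sym (toℕ-fromℕ< (s≤s n≤j))) q) , toℕ-fromℕ< (s≤s n≤j))

ones-++ : ∀ {k n} (xs : Vec Bool k) (ys : Vec Bool n) → ones (xs ++ ys) ≡ ones xs + ones ys
ones-++ []           ys = refl
ones-++ (true  ∷ xs) ys = cong suc (ones-++ xs ys)
ones-++ (false ∷ xs) ys = ones-++ xs ys

ones-∷ : ∀ {j} x (t : Vec Bool j) → ones (x ∷ t) ≡ ones (x ∷ []) + ones t
ones-∷ x = ones-++ (x ∷ [])

ones-replicate : ∀ n b → ones (replicate n b) ≡ (if b then n else 0)
ones-replicate zero    true  = refl
ones-replicate zero    false = refl
ones-replicate (suc n) true  = cong suc (ones-replicate n true)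
ones-replicate (suc n) false = ones-replicate n false

ones≤length : ∀ {j} (t : Vec Bool j) → ones t ≤ j
ones≤length = count≤n T?

ones≡0⇒≡replicate-false : ∀ {j} (t : Vec Bool j) → ones t ≡ 0 → t ≡ replicate j false
ones≡0⇒≡replicate-false []          _  = refl
ones≡0⇒≡replicate-false (false ∷ t) eq = cong (false ∷_) (ones≡0⇒≡replicate-false t eq)

ones≡length⇒≡replicate-true : ∀ {j} (t : Vec Bool j) → ones t ≡ j → t ≡ replicate j true
ones≡length⇒≡replicate-true []          _  = refl
ones≡length⇒≡replicate-true (true  ∷ t) eq =
  cong (true ∷_) (ones≡length⇒≡replicate-true t (cong pred eq))
ones≡length⇒≡replicate-true (false ∷ t) eq = ⊥-elim (1+n≰n (subst (_≤ _) eq (ones≤length t)))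

ones+ones-map-not : ∀ {j} (t : Vec Bool j) → ones t + ones (map not t) ≡ j
ones+ones-map-not []          = refl
ones+ones-map-not (true  ∷ t) = cong suc (ones+ones-map-not t)
ones+ones-map-not (false ∷ t) = trans (+-suc (ones t) _) (cong suc (ones+ones-map-not t))

R[full]-total : ∀ {j} {S : Subset (suc j)} → (∀ s → s ∈ S) → ∀ t → R[ S ] t
R[full]-total full t = _ , full _ , toℕ-fromℕ< (s≤s (ones≤length t))

R[⊆0j]-constant : ∀ {j} {S : Subset (suc j)} → (∀ s → s ∈ S → toℕ s ≡ 0 ⊎ toℕ s ≡ j) →
                  ∀ t → R[ S ] t → ∃[ b ] t ≡ replicate j b
R[⊆0j]-constant ⊆0j t (s , s∈S , eq) with ⊆0j s s∈S
... | inj₁ ≡0 = false , ones≡0⇒≡replicate-false t (trans (sym eq) ≡0)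
... | inj₂ ≡j = true  , ones≡length⇒≡replicate-true t (trans (sym eq) ≡j)

pointwise : ∀ {j} → (Bool → Bool → Bool → Bool) →
            Vec Bool j → Vec Bool j → Vec Bool j → Vec Bool j
pointwise f []      []      []      = []
pointwise f (x ∷ t) (y ∷ u) (z ∷ v) = f x y z ∷ pointwise f t u v

ClosedUnder : ∀ {j} → (Bool → Bool → Bool → Bool) → BoolRel j → Set
ClosedUnder f R = ∀ t u v → R t → R u → R v → R (pointwise f t u v)

xor3 : Bool → Bool → Bool → Bool
xor3 x y z = (x xor y) xor z

majVec≡pointwise-maj : ∀ {j} (t u v : Vec Bool j) → majVec t u v ≡ pointwise maj t u v
majVec≡pointwise-maj []      []      []      = refl
majVec≡pointwise-maj (x ∷ t) (y ∷ u) (z ∷ v) = cong (maj x y z ∷_) (majVec≡pointwise-maj t u v)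

xor3Vec≡pointwise-xor3 : ∀ {j} (t u v : Vec Bool j) → xor3Vec t u v ≡ pointwise xor3 t u v
xor3Vec≡pointwise-xor3 []      []      []      = refl
xor3Vec≡pointwise-xor3 (x ∷ t) (y ∷ u) (z ∷ v) =
  cong (xor3 x y z ∷_) (xor3Vec≡pointwise-xor3 t u v)

bijunctive⇔closedUnder-maj : ∀ {j} {R : BoolRel j} → Bijunctive R ⇔ ClosedUnder maj R
bijunctive⇔closedUnder-maj {R = R} = mk⇔
  (λ B t u v rt ru rv → subst R (majVec≡pointwise-maj t u v) (B t u v rt ru rv))
  (λ C t u v rt ru rv → subst R (sym (majVec≡pointwise-maj t u v)) (C t u v rt ru rv))

affine⇔closedUnder-xor3 : ∀ {j} {R : BoolRel j} → Affine R ⇔ ClosedUnder xor3 R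
affine⇔closedUnder-xor3 {R = R} = mk⇔
  (λ A t u v rt ru rv → subst R (xor3Vec≡pointwise-xor3 t u v) (A t u v rt ru rv))
  (λ C t u v rt ru rv → subst R (sym (xor3Vec≡pointwise-xor3 t u v)) (C t u v rt ru rv))

pointwise-++ : ∀ {k n} f (x₁ x₂ x₃ : Vec Bool k) (y₁ y₂ y₃ : Vec Bool n) →
  pointwise f (x₁ ++ y₁) (x₂ ++ y₂) (x₃ ++ y₃) ≡ pointwise f x₁ x₂ x₃ ++ pointwise f y₁ y₂ y₃
pointwise-++ f []       []       []       y₁ y₂ y₃ = refl
pointwise-++ f (a ∷ x₁) (b ∷ x₂) (c ∷ x₃) y₁ y₂ y₃ =
  cong (f a b c ∷_) (pointwise-++ f x₁ x₂ x₃ y₁ y₂ y₃)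

pointwise-replicate : ∀ f n a b c →
  pointwise f (replicate n a) (replicate n b) (replicate n c) ≡ replicate n (f a b c)
pointwise-replicate f zero    a b c = refl
pointwise-replicate f (suc n) a b c = cong (f a b c ∷_) (pointwise-replicate f n a b c)

closedUnder-resp-⇔ : ∀ {j f} {R R′ : BoolRel j} → (∀ t → R t ⇔ R′ t) →
                     ClosedUnder f R → ClosedUnder f R′
closedUnder-resp-⇔ R⇔R′ closed t u v rt ru rv =
  to (R⇔R′ _) (closed t u v (from (R⇔R′ t) rt) (from (R⇔R′ u) ru) (from (R⇔R′ v) rv))

closedUnder-total : ∀ {j f} {R : BoolRel j} → (∀ t → R t) → ClosedUnder f R
closedUnder-total total t u v _ _ _ = total _

OneOf : ∀ {A : Set} → A → A → A → A → Set
OneOf w x y z = w ≡ x ⊎ w ≡ y ⊎ w ≡ z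

closedUnder-selective : ∀ {j f} {R : BoolRel j} →
  (∀ t u v → R t → R u → R v → OneOf (pointwise f t u v) t u v) → ClosedUnder f R
closedUnder-selective {R = R} selects t u v rt ru rv with selects t u v rt ru rv
... | inj₁ ≡t        = subst R (sym ≡t) rt
... | inj₂ (inj₁ ≡u) = subst R (sym ≡u) ru
... | inj₂ (inj₂ ≡v) = subst R (sym ≡v) rv

bool-cases : ∀ b → b ≡ false ⊎ b ≡ true
bool-cases false = inj₁ refl
bool-cases true  = inj₂ refl

idempotent⇒conservative : ∀ {f : Bool → Bool → Bool → Bool} → (∀ b → f b b b ≡ b) →
                          ∀ x y z → OneOf (f x y z) x y z
idempotent⇒conservative f-idem false false false = inj₁ (f-idem false)
idempotent⇒conservative f-idem true  true  true  = inj₁ (f-idem true)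
idempotent⇒conservative {f} _ false false true with bool-cases (f false false true)
... | inj₁ eq = inj₁ eq
... | inj₂ eq = inj₂ (inj₂ eq)
idempotent⇒conservative {f} _ true true false with bool-cases (f true true false)
... | inj₁ eq = inj₂ (inj₂ eq)
... | inj₂ eq = inj₁ eq
idempotent⇒conservative {f} _ false true z with bool-cases (f false true z)
... | inj₁ eq = inj₁ eq
... | inj₂ eq = inj₂ (inj₁ eq)
idempotent⇒conservative {f} _ true false z with bool-cases (f true false z)
... | inj₁ eq = inj₂ (inj₁ eq)
... | inj₂ eq = inj₁ eq

closedUnder-constant : ∀ {j f} {R : BoolRel j} → (∀ b → f b b b ≡ b) →
  (∀ t → R t → ∃[ b ] t ≡ replicate j b) → ClosedUnder f R
closedUnder-constant {j} {f} {R} f-idem constant = closedUnder-selective selects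
  where
  selects : ∀ t u v → R t → R u → R v → OneOf (pointwise f t u v) t u v
  selects t u v rt ru rv with constant t rt | constant u ru | constant v rv
  ... | b₁ , refl | b₂ , refl | b₃ , refl =
    map-⊎ lift (map-⊎ lift lift) (idempotent⇒conservative f-idem b₁ b₂ b₃)
    where
    lift : ∀ {b} → f b₁ b₂ b₃ ≡ b →
           pointwise f (replicate j b₁) (replicate j b₂) (replicate j b₃) ≡ replicate j b
    lift eq = trans (pointwise-replicate f j b₁ b₂ b₃) (cong (replicate j) eq)

module Padding {f : Bool → Bool → Bool → Bool} (f-idem : ∀ b → f b b b ≡ b) where

  pad : ∀ {k} a r → Bool → Vec Bool k → Vec Bool (k + a + r)
  pad a r b x = (x ++ replicate a b) ++ replicate r false

  ones-pad : ∀ {k} a r b (x : Vec Bool k) → ones (pad a r b x) ≡ ones x + (if b then a else 0)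
  ones-pad a r b x = begin
    ones ((x ++ replicate a b) ++ replicate r false)     ≡⟨ ones-++ (x ++ replicate a b) _ ⟩
    ones (x ++ replicate a b) + ones (replicate r false)
      ≡⟨ cong₂ _+_ (ones-++ x _) (ones-replicate r false) ⟩
    ones x + ones (replicate a b) + 0                    ≡⟨ +-identityʳ _ ⟩
    ones x + ones (replicate a b)                        ≡⟨ cong (ones x +_) (ones-replicate a b) ⟩
    ones x + (if b then a else 0)                        ∎
    where open ≡-Reasoning

  pointwise-pad : ∀ {k} a r b₁ b₂ b₃ (x y z : Vec Bool k) →
    pointwise f (pad a r b₁ x) (pad a r b₂ y) (pad a r b₃ z) ≡ pad a r (f b₁ b₂ b₃) (pointwise f x y z)
  pointwise-pad a r b₁ b₂ b₃ x y z = begin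
    pointwise f (pad a r b₁ x) (pad a r b₂ y) (pad a r b₃ z)
      ≡⟨ pointwise-++ f (x ++ replicate a b₁) (y ++ replicate a b₂) (z ++ replicate a b₃) _ _ _ ⟩
    pointwise f (x ++ replicate a b₁) (y ++ replicate a b₂) (z ++ replicate a b₃)
      ++ pointwise f (replicate r false) (replicate r false) (replicate r false)
      ≡⟨ cong₂ _++_ (pointwise-++ f x y z _ _ _) (pointwise-replicate f r false false false) ⟩
    (pointwise f x y z ++ pointwise f (replicate a b₁) (replicate a b₂) (replicate a b₃))
      ++ replicate r (f false false false)
      ≡⟨ cong₂ (λ p q → (pointwise f x y z ++ p) ++ replicate r q)
               (pointwise-replicate f a b₁ b₂ b₃) (f-idem false) ⟩
    pad a r (f b₁ b₂ b₃) (pointwise f x y z) ∎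
    where open ≡-Reasoning

  weight-transfer : ∀ {j} {S : Subset (suc j)} → ClosedUnder f R[ S ] →
    ∀ {k a} (x y z : Vec Bool k) (b₁ b₂ b₃ : Bool) → k + a ≤ j →
    ones x + (if b₁ then a else 0) ∈ₙ S → ones y + (if b₂ then a else 0) ∈ₙ S →
    ones z + (if b₃ then a else 0) ∈ₙ S →
    ones (pointwise f x y z) + (if f b₁ b₂ b₃ then a else 0) ∈ₙ S
  weight-transfer {S = S} closed {a = a} x y z b₁ b₂ b₃ k+a≤j wx wy wz
    with m≤n⇒∃[o]m+o≡n k+a≤j
  ... | r , refl =
    subst (_∈ₙ S)
      (trans (cong ones (pointwise-pad a r b₁ b₂ b₃ x y z)) (ones-pad a r _ (pointwise f x y z)))
      (closed (pad a r b₁ x) (pad a r b₂ y) (pad a r b₃ z)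
        (subst (_∈ₙ S) (sym (ones-pad a r b₁ x)) wx)
        (subst (_∈ₙ S) (sym (ones-pad a r b₂ y)) wy)
        (subst (_∈ₙ S) (sym (ones-pad a r b₃ z)) wz))

-- Multiples are written q * s so that suc q * s unfolds to s + q * s.
module Ladder {P : ℕ → Set} (s : ℕ) where

  private
    reassoc : ∀ q {m b} → s + q * s + m ≤ b → s + (q * s + m) ≤ b
    reassoc q {m} {b} = subst (_≤ b) (+-assoc s (q * s) m)

  ascend : ∀ {m b} → (∀ {n} → m ≤ n → s + n ≤ b → P n → P (s + n)) → P m →
           ∀ {n} q → q * s + m ≡ n → n ≤ b → P n
  ascend step Pm zero    refl _   = Pm
  ascend {m} step Pm (suc q) refl n≤b =
    subst P (sym (+-assoc s (q * s) m))
      (step (m≤n+m m (q * s)) (reassoc q n≤b)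
            (ascend step Pm q refl (≤-trans (m≤n+m _ s) (reassoc q n≤b))))

  descend : ∀ {m b} → (∀ {n} → s + n ≤ b → P (s + n) → P n) →
            ∀ {n} q → q * s + m ≡ n → n ≤ b → P n → P m
  descend step zero    refl _   Pn = Pn
  descend {m} step (suc q) refl n≤b Pn =
    descend step q refl (≤-trans (m≤n+m _ s) (reassoc q n≤b))
      (step (reassoc q n≤b) (subst P (+-assoc s (q * s) m) Pn))

≤⇒steps₁ : ∀ {m n} → m ≤ n → ∃[ q ] q * 1 + m ≡ n
≤⇒steps₁ {m} m≤n with m≤n⇒∃[o]m+o≡n m≤n
... | o , m+o≡n = o , trans (cong (_+ m) (*-identityʳ o)) (trans (+-comm o m) m+o≡n)

-- Majority

BijunctiveWeightSet : ∀ j → Subset (suc j) → Set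
BijunctiveWeightSet j S =
  (∀ (s : Fin (suc j)) → s ∈ S)
  ⊎ (∀ (s : Fin (suc j)) → s ∈ S → (toℕ s ≡ 0 ⊎ toℕ s ≡ j))
  ⊎ (∀ (s : Fin (suc j)) → (s ∈ S ⇔ (toℕ s ≡ 0 ⊎ toℕ s ≡ 1)))
  ⊎ (∀ (s : Fin (suc j)) → (s ∈ S ⇔ (toℕ s ≡ j ∸ 1 ⊎ toℕ s ≡ j)))
  ⊎ j ≤ 2

maj-idem : ∀ b → maj b b b ≡ b
maj-idem false = refl
maj-idem true  = refl

-- Each gadget gives three short tuples and the bit each is padded with; e.g. grow pads
-- 110, 011, 101 with n ones, and their majority is 111 followed by n ones.
module MajorityGadgets {j} {S : Subset (suc j)} (closed : ClosedUnder maj R[ S ]) where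
  open Padding {maj} maj-idem

  grow : ∀ {n} → 3 + n ≤ j → 2 + n ∈ₙ S → 3 + n ∈ₙ S
  grow le w = weight-transfer closed (true ∷ true ∷ false ∷ []) (false ∷ true ∷ true ∷ [])
                (true ∷ false ∷ true ∷ []) true true true le w w w

  shrink : ∀ {n} → 3 + n ≤ j → 1 + n ∈ₙ S → n ∈ₙ S
  shrink le w = weight-transfer closed (true ∷ false ∷ false ∷ []) (false ∷ true ∷ false ∷ [])
                  (false ∷ false ∷ true ∷ []) true true true le w w w

  shrink-with-0 : ∀ {n} → 2 + n ≤ j → 0 ∈ₙ S → 1 + n ∈ₙ S → n ∈ₙ S
  shrink-with-0 le w₀ w = weight-transfer closed (false ∷ false ∷ []) (false ∷ true ∷ [])
                            (true ∷ false ∷ []) false true true le w₀ w w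

  two-from-1 : ∀ {n} → 2 + n ≤ j → 1 ∈ₙ S → 2 + n ∈ₙ S → 2 ∈ₙ S
  two-from-1 le w₁ w = weight-transfer closed (true ∷ false ∷ []) (false ∷ true ∷ [])
                         (true ∷ true ∷ []) false false true le w₁ w₁ w

module MajorityWeights {j} {S : Subset (suc j)} (closed : ClosedUnder maj R[ S ]) where
  open MajorityGadgets closed public
  open Ladder {_∈ₙ S} 1

  below : ∀ {w n} → 2 + w ≤ j → w ∈ₙ S → n ≤ w → n ∈ₙ S
  below 2+w≤j w∈S n≤w =
    let q , eq = ≤⇒steps₁ n≤w in
    descend (λ 1+k≤w → shrink (≤-trans (s≤s (s≤s 1+k≤w)) 2+w≤j)) q eq ≤-refl w∈S

  above : ∀ {w n} → 2 ≤ w → w ∈ₙ S → w ≤ n → n ≤ j → n ∈ₙ S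
  above {w} 2≤w w∈S w≤n n≤j =
    let q , eq = ≤⇒steps₁ w≤n in ascend step w∈S q eq n≤j
    where
    step : ∀ {k} → w ≤ k → 1 + k ≤ j → k ∈ₙ S → 1 + k ∈ₙ S
    step w≤k with ≤-trans 2≤w w≤k
    ... | s≤s (s≤s _) = grow

≤2+⇒≤∨≡1+∨≡2+ : ∀ {n k} → n ≤ 2 + k → n ≤ k ⊎ n ≡ 1 + k ⊎ n ≡ 2 + k
≤2+⇒≤∨≡1+∨≡2+ n≤2+k with m≤n⇒m<n∨m≡n n≤2+k
... | inj₂ n≡2+k = inj₂ (inj₂ n≡2+k)
... | inj₁ n<2+k with m≤n⇒m<n∨m≡n (≤-pred n<2+k)
...   | inj₁ n<1+k = inj₁ (≤-pred n<1+k)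
...   | inj₂ n≡1+k = inj₂ (inj₁ n≡1+k)

module MajorityClassification {m} {S : Subset (4 + m)} (closed : ClosedUnder maj R[ S ]) where
  open MajorityWeights closed

  from-1-and-heavy : ∀ {n} → 1 ∈ₙ S → n ∈ₙ S → 2 ≤ n → ∀ {k} → 2 ≤ k → k ≤ 3 + m → k ∈ₙ S
  from-1-and-heavy w₁ w (s≤s (s≤s _)) = above ≤-refl (two-from-1 (∈ₙ⇒≤ w) w₁ w)

  from-penultimate-and-light : ∀ {n} → 2 + m ∈ₙ S → n ∈ₙ S → n ≤ 1 + m →
                               ∀ {k} → k ≤ 1 + m → k ∈ₙ S
  from-penultimate-and-light wₚ w n≤1+m =
    below ≤-refl (shrink-with-0 ≤-refl (below (s≤s (s≤s n≤1+m)) w z≤n) wₚ)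

  classify : BijunctiveWeightSet (3 + m) S
  classify with 1 ∈ₙ? S | (2 + m) ∈ₙ? S
  ... | yes w₁ | yes wₚ = inj₁ λ s → ∈ₙ⇒∈ (all (toℕ≤pred[n] s))
    where
    all : ∀ {n} → n ≤ 3 + m → n ∈ₙ S
    all {0}           _   = shrink (s≤s (s≤s (s≤s z≤n))) w₁
    all {1}           _   = w₁
    all {suc (suc _)} n≤j = from-1-and-heavy w₁ wₚ (s≤s (s≤s z≤n)) (s≤s (s≤s z≤n)) n≤j
  ... | yes w₁ | no ¬wₚ = inj₂ (inj₂ (inj₁ (∈⇔-from-weights sound complete)))
    where
    sound : ∀ {n} → n ∈ₙ S → n ≡ 0 ⊎ n ≡ 1
    sound {0}           _ = inj₁ refl
    sound {1}           _ = inj₂ refl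
    sound {suc (suc _)} w =
      ⊥-elim (¬wₚ (from-1-and-heavy w₁ w (s≤s (s≤s z≤n)) (s≤s (s≤s z≤n)) (n≤1+n _)))
    complete : ∀ {n} → n ≤ 3 + m → n ≡ 0 ⊎ n ≡ 1 → n ∈ₙ S
    complete _ (inj₁ refl) = shrink (s≤s (s≤s (s≤s z≤n))) w₁
    complete _ (inj₂ refl) = w₁
  ... | no ¬w₁ | yes wₚ = inj₂ (inj₂ (inj₂ (inj₁ (∈⇔-from-weights sound complete))))
    where
    sound : ∀ {n} → n ∈ₙ S → n ≡ 2 + m ⊎ n ≡ 3 + m
    sound w with ≤2+⇒≤∨≡1+∨≡2+ (∈ₙ⇒≤ w)
    ... | inj₁ n≤1+m = ⊥-elim (¬w₁ (from-penultimate-and-light wₚ w n≤1+m (s≤s z≤n)))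
    ... | inj₂ top   = top
    complete : ∀ {n} → n ≤ 3 + m → n ≡ 2 + m ⊎ n ≡ 3 + m → n ∈ₙ S
    complete _ (inj₁ refl) = wₚ
    complete _ (inj₂ refl) = grow ≤-refl wₚ
  ... | no ¬w₁ | no ¬wₚ = inj₂ (inj₁ λ s s∈S → sound (∈⇒∈ₙ s∈S))
    where
    sound : ∀ {n} → n ∈ₙ S → n ≡ 0 ⊎ n ≡ 3 + m
    sound {0}     _ = inj₁ refl
    sound {suc _} w with ≤2+⇒≤∨≡1+∨≡2+ (∈ₙ⇒≤ w)
    ... | inj₁ n≤1+m       = ⊥-elim (¬w₁ (below (s≤s (s≤s n≤1+m)) w (s≤s z≤n)))
    ... | inj₂ (inj₁ refl) = ⊥-elim (¬wₚ w)
    ... | inj₂ (inj₂ n≡j)  = inj₂ n≡j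

closedUnder-maj⇒weightSet : ∀ j {S : Subset (suc j)} → ClosedUnder maj R[ S ] → BijunctiveWeightSet j S
closedUnder-maj⇒weightSet 0                   _      = inj₂ (inj₂ (inj₂ (inj₂ z≤n)))
closedUnder-maj⇒weightSet 1                   _      = inj₂ (inj₂ (inj₂ (inj₂ (s≤s z≤n))))
closedUnder-maj⇒weightSet 2                   _      = inj₂ (inj₂ (inj₂ (inj₂ (s≤s (s≤s z≤n)))))
closedUnder-maj⇒weightSet (suc (suc (suc m))) closed = MajorityClassification.classify closed

maj-weight : ∀ x y z → 2 * ones (maj x y z ∷ []) ≤ ones (x ∷ []) + ones (y ∷ []) + ones (z ∷ [])
maj-weight false false _     = z≤n
maj-weight true  true  false = ≤-refl
maj-weight true  true  true  = n≤1+n 2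
maj-weight false true  false = z≤n
maj-weight false true  true  = ≤-refl
maj-weight true  false false = z≤n
maj-weight true  false true  = ≤-refl

twice-ones-majority≤ : ∀ {j} (t u v : Vec Bool j) →
                       2 * ones (pointwise maj t u v) ≤ ones t + ones u + ones v
twice-ones-majority≤ []      []      []      = z≤n
twice-ones-majority≤ (x ∷ t) (y ∷ u) (z ∷ v) = begin
  2 * ones (maj x y z ∷ pointwise maj t u v)
    ≡⟨ cong (2 *_) (ones-∷ (maj x y z) (pointwise maj t u v)) ⟩
  2 * (ones (maj x y z ∷ []) + ones (pointwise maj t u v))
    ≡⟨ *-distribˡ-+ 2 (ones (maj x y z ∷ [])) _ ⟩
  2 * ones (maj x y z ∷ []) + 2 * ones (pointwise maj t u v)
    ≤⟨ +-mono-≤ (maj-weight x y z) (twice-ones-majority≤ t u v) ⟩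
  (ones (x ∷ []) + ones (y ∷ []) + ones (z ∷ [])) + (ones t + ones u + ones v)
    ≡⟨ interchange₃ (ones (x ∷ [])) (ones (y ∷ [])) (ones (z ∷ [])) (ones t) (ones u) (ones v) ⟩
  (ones (x ∷ []) + ones t) + (ones (y ∷ []) + ones u) + (ones (z ∷ []) + ones v)
    ≡⟨ sym (cong₂ _+_ (cong₂ _+_ (ones-∷ x t) (ones-∷ y u)) (ones-∷ z v)) ⟩
  ones (x ∷ t) + ones (y ∷ u) + ones (z ∷ v) ∎
  where
  open ≤-Reasoning
  interchange₃ : ∀ a b c d e f → (a + b + c) + (d + e + f) ≡ (a + d) + (b + e) + (c + f)
  interchange₃ = solve-∀

ones≤1-closedUnder-maj : ∀ {j} → ClosedUnder maj (λ (t : Vec Bool j) → ones t ≤ 1)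
ones≤1-closedUnder-maj t u v t≤1 u≤1 v≤1 =
  ≤-pred (*-cancelˡ-< 2 _ 2 (s≤s (≤-trans (twice-ones-majority≤ t u v)
                                          (+-mono-≤ (+-mono-≤ t≤1 u≤1) v≤1))))

SelfDual : (Bool → Bool → Bool → Bool) → Set
SelfDual f = ∀ x y z → f (not x) (not y) (not z) ≡ not (f x y z)

maj-selfDual : SelfDual maj
maj-selfDual false false false = refl
maj-selfDual false false true  = refl
maj-selfDual false true  false = refl
maj-selfDual false true  true  = refl
maj-selfDual true  false false = refl
maj-selfDual true  false true  = refl
maj-selfDual true  true  false = refl
maj-selfDual true  true  true  = refl

pointwise-map-not : ∀ {j f} → SelfDual f → (t u v : Vec Bool j) →
                    pointwise f (map not t) (map not u) (map not v) ≡ map not (pointwise f t u v)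
pointwise-map-not f-dual []      []      []      = refl
pointwise-map-not f-dual (x ∷ t) (y ∷ u) (z ∷ v) =
  cong₂ _∷_ (f-dual x y z) (pointwise-map-not f-dual t u v)

closedUnder-complement : ∀ {j f} {R : BoolRel j} → SelfDual f →
                         ClosedUnder f R → ClosedUnder f (R ∘ map not)
closedUnder-complement {R = R} f-dual closed t u v rt ru rv =
  subst R (pointwise-map-not f-dual t u v) (closed (map not t) (map not u) (map not v) rt ru rv)

≤1⇔≡0∨≡1 : ∀ {n} → n ≤ 1 ⇔ (n ≡ 0 ⊎ n ≡ 1)
≤1⇔≡0∨≡1 = mk⇔ n≤1⇒n≡0∨n≡1 λ { (inj₁ refl) → z≤n ; (inj₂ refl) → s≤s z≤n }

≡∸1∨≡⇔complement≤1 : ∀ {n z j} → n + z ≡ j → (n ≡ j ∸ 1 ⊎ n ≡ j) ⇔ z ≤ 1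
≡∸1∨≡⇔complement≤1 {n} {z} refl = mk⇔ (to′ z) from′
  where
  to′ : ∀ z → n ≡ n + z ∸ 1 ⊎ n ≡ n + z → z ≤ 1
  to′ z             (inj₂ n≡n+z) = subst (_≤ 1) (+-cancelˡ-≡ n 0 z (trans (+-identityʳ n) n≡n+z)) z≤n
  to′ 0             (inj₁ _)     = z≤n
  to′ 1             (inj₁ _)     = ≤-refl
  to′ (suc (suc k)) (inj₁ n≡n+z∸1) =
    ⊥-elim (m≢1+m+n n (trans n≡n+z∸1 (trans (cong (_∸ 1) (+-suc n (suc k))) (+-suc n k))))
  from′ : ∀ {z} → z ≤ 1 → n ≡ n + z ∸ 1 ⊎ n ≡ n + z
  from′ z≤n       = inj₂ (sym (+-identityʳ n))
  from′ (s≤s z≤n) = inj₁ (sym (m+n∸n≡m n 1))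

maj-agrees-with-two : ∀ x y z → (maj x y z ≡ x × maj x y z ≡ y) ⊎ (maj x y z ≡ y × maj x y z ≡ z)
                                ⊎ (maj x y z ≡ x × maj x y z ≡ z)
maj-agrees-with-two false false _     = inj₁ (refl , refl)
maj-agrees-with-two true  true  _     = inj₁ (refl , refl)
maj-agrees-with-two false true  false = inj₂ (inj₂ (refl , refl))
maj-agrees-with-two false true  true  = inj₂ (inj₁ (refl , refl))
maj-agrees-with-two true  false false = inj₂ (inj₁ (refl , refl))
maj-agrees-with-two true  false true  = inj₂ (inj₂ (refl , refl))

pair-cong : ∀ {a b c d : Bool} → a ≡ c → b ≡ d → a ∷ b ∷ [] ≡ c ∷ d ∷ []
pair-cong = cong₂ (λ p q → p ∷ q ∷ [])

-- On two coordinates, the pairs of arguments that the majority agrees with share an argument.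
majority-selective-≤2 : ∀ {j} → j ≤ 2 → (t u v : Vec Bool j) → OneOf (pointwise maj t u v) t u v
majority-selective-≤2 _ [] [] [] = inj₁ refl
majority-selective-≤2 _ (x ∷ []) (y ∷ []) (z ∷ []) with maj-agrees-with-two x y z
... | inj₁ (≡x , _)        = inj₁ (cong (_∷ []) ≡x)
... | inj₂ (inj₁ (≡y , _)) = inj₂ (inj₁ (cong (_∷ []) ≡y))
... | inj₂ (inj₂ (_ , ≡z)) = inj₂ (inj₂ (cong (_∷ []) ≡z))
majority-selective-≤2 _ (x₁ ∷ x₂ ∷ []) (y₁ ∷ y₂ ∷ []) (z₁ ∷ z₂ ∷ [])
  with maj-agrees-with-two x₁ y₁ z₁ | maj-agrees-with-two x₂ y₂ z₂
... | inj₁ (a , _)        | inj₁ (b , _)        = inj₁ (pair-cong a b)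
... | inj₁ (_ , a)        | inj₂ (inj₁ (b , _)) = inj₂ (inj₁ (pair-cong a b))
... | inj₁ (a , _)        | inj₂ (inj₂ (b , _)) = inj₁ (pair-cong a b)
... | inj₂ (inj₁ (a , _)) | inj₁ (_ , b)        = inj₂ (inj₁ (pair-cong a b))
... | inj₂ (inj₁ (a , _)) | inj₂ (inj₁ (b , _)) = inj₂ (inj₁ (pair-cong a b))
... | inj₂ (inj₁ (_ , a)) | inj₂ (inj₂ (_ , b)) = inj₂ (inj₂ (pair-cong a b))
... | inj₂ (inj₂ (a , _)) | inj₁ (b , _)        = inj₁ (pair-cong a b)
... | inj₂ (inj₂ (_ , a)) | inj₂ (inj₁ (_ , b)) = inj₂ (inj₂ (pair-cong a b))
... | inj₂ (inj₂ (a , _)) | inj₂ (inj₂ (b , _)) = inj₁ (pair-cong a b)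
majority-selective-≤2 (s≤s (s≤s ())) (_ ∷ _ ∷ _ ∷ _) _ _

weightSet⇒closedUnder-maj : ∀ {j} {S : Subset (suc j)} → BijunctiveWeightSet j S → ClosedUnder maj R[ S ]
weightSet⇒closedUnder-maj (inj₁ full) = closedUnder-total (R[full]-total full)
weightSet⇒closedUnder-maj (inj₂ (inj₁ ⊆0j)) = closedUnder-constant maj-idem (R[⊆0j]-constant ⊆0j)
weightSet⇒closedUnder-maj (inj₂ (inj₂ (inj₁ S≡01))) =
  closedUnder-resp-⇔
    (λ t → ⇔-sym (∈ₙ⇔-from-∈⇔ {Q = λ n → n ≡ 0 ⊎ n ≡ 1} S≡01 (ones≤length t)) ⇔-∘ ≤1⇔≡0∨≡1)
    ones≤1-closedUnder-maj
weightSet⇒closedUnder-maj {j} (inj₂ (inj₂ (inj₂ (inj₁ S≡top)))) =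
  closedUnder-resp-⇔
    (λ t → ⇔-sym (∈ₙ⇔-from-∈⇔ {Q = λ n → n ≡ j ∸ 1 ⊎ n ≡ j} S≡top (ones≤length t))
           ⇔-∘ ⇔-sym (≡∸1∨≡⇔complement≤1 (ones+ones-map-not t)))
    (closedUnder-complement maj-selfDual ones≤1-closedUnder-maj)
weightSet⇒closedUnder-maj (inj₂ (inj₂ (inj₂ (inj₂ j≤2)))) =
  closedUnder-selective (λ t u v _ _ _ → majority-selective-≤2 j≤2 t u v)

bijunctive⇔weightSet : ∀ j (S : Subset (suc j)) → Bijunctive (R[_] {j} S) ⇔ BijunctiveWeightSet j S
bijunctive⇔weightSet j S =
  mk⇔ (closedUnder-maj⇒weightSet j ∘ to bijunctive⇔closedUnder-maj)
      (from bijunctive⇔closedUnder-maj ∘ weightSet⇒closedUnder-maj)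

-- Parity and xor

AffineWeightSet : ∀ j → Subset (suc j) → Set
AffineWeightSet j S =
  (∀ (s : Fin (suc j)) → s ∈ S)
  ⊎ (∀ (s : Fin (suc j)) → s ∈ S → (toℕ s ≡ 0 ⊎ toℕ s ≡ j))
  ⊎ (∀ (s : Fin (suc j)) → (s ∈ S ⇔ IsEven (toℕ s)))
  ⊎ (∀ (s : Fin (suc j)) → (s ∈ S ⇔ IsOdd (toℕ s)))

even⇔parity≡0ℙ : ∀ n → IsEven n ⇔ parity n ≡ 0ℙ
even⇔parity≡0ℙ 0             = mk⇔ (λ _ → refl) (λ _ → refl)
even⇔parity≡0ℙ 1             = mk⇔ (λ ()) (λ ())
even⇔parity≡0ℙ (suc (suc n)) = even⇔parity≡0ℙ n

odd⇔parity≡1ℙ : ∀ n → IsOdd n ⇔ parity n ≡ 1ℙ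
odd⇔parity≡1ℙ 0             = mk⇔ (λ ()) (λ ())
odd⇔parity≡1ℙ 1             = mk⇔ (λ _ → refl) (λ _ → refl)
odd⇔parity≡1ℙ (suc (suc n)) = odd⇔parity≡1ℙ n

parity-two-valued : ∀ {p q : Parity} → p ≢ q → ∀ r → r ≡ p ⊎ r ≡ q
parity-two-valued {0ℙ} {0ℙ} p≢q _  = ⊥-elim (p≢q refl)
parity-two-valued {1ℙ} {1ℙ} p≢q _  = ⊥-elim (p≢q refl)
parity-two-valued {0ℙ} {1ℙ} _   0ℙ = inj₁ refl
parity-two-valued {0ℙ} {1ℙ} _   1ℙ = inj₂ refl
parity-two-valued {1ℙ} {0ℙ} _   0ℙ = inj₂ refl
parity-two-valued {1ℙ} {0ℙ} _   1ℙ = inj₁ refl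

parity-suc-≢ : ∀ n → parity n ≢ parity (suc n)
parity-suc-≢ n eq = p≢p⁻¹ (parity n) (trans eq (+-homo-+ 1 n))

≢⇒parity-suc≡ : ∀ {n p} → parity n ≢ p → parity (suc n) ≡ p
≢⇒parity-suc≡ {n} {p} pn≢p with parity-two-valued (parity-suc-≢ n) p
... | inj₁ p≡pn  = ⊥-elim (pn≢p (sym p≡pn))
... | inj₂ p≡psn = sym p≡psn

≢⇒parity-pred≡ : ∀ {n p} → 1 ≤ n → parity n ≢ p → parity (pred n) ≡ p
≢⇒parity-pred≡ {suc n} {p} _ psn≢p with parity-two-valued (parity-suc-≢ n) p
... | inj₁ p≡pn  = sym p≡pn
... | inj₂ p≡psn = ⊥-elim (psn≢p (sym p≡psn))

parity≡0ℙ⇒∃[q]≡q*2 : ∀ n → parity n ≡ 0ℙ → ∃[ q ] q * 2 ≡ n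
parity≡0ℙ⇒∃[q]≡q*2 0             _  = 0 , refl
parity≡0ℙ⇒∃[q]≡q*2 (suc (suc n)) eq =
  let q , q*2≡n = parity≡0ℙ⇒∃[q]≡q*2 n eq in suc q , cong (2 +_) q*2≡n

parity-+-cancelˡ : ∀ m o → parity m ≡ parity (m + o) → parity o ≡ 0ℙ
parity-+-cancelˡ m o pm≡pm+o = +ℙ-cancelˡ-≡ (parity m) _ _ (begin
  parity m +ℙ parity o  ≡⟨ sym (+-homo-+ m o) ⟩
  parity (m + o)        ≡⟨ sym pm≡pm+o ⟩
  parity m              ≡⟨ sym (+ℙ-identityʳ (parity m)) ⟩
  parity m +ℙ 0ℙ        ∎)
  where open ≡-Reasoning

≤∧same-parity⇒steps₂ : ∀ {m n} → m ≤ n → parity m ≡ parity n → ∃[ q ] q * 2 + m ≡ n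
≤∧same-parity⇒steps₂ {m} m≤n pm≡pn with m≤n⇒∃[o]m+o≡n m≤n
... | o , refl with parity≡0ℙ⇒∃[q]≡q*2 o (parity-+-cancelˡ m o pm≡pn)
...   | q , refl = q , +-comm (q * 2) m

parity-ones-zipWith-xor : ∀ {j} (t u : Vec Bool j) →
  parity (ones (zipWith _xor_ t u)) ≡ parity (ones t) +ℙ parity (ones u)
parity-ones-zipWith-xor []      []      = refl
parity-ones-zipWith-xor (x ∷ t) (y ∷ u) = begin
  parity (ones ((x xor y) ∷ zipWith _xor_ t u))
    ≡⟨ parity-ones-∷ (x xor y) (zipWith _xor_ t u) ⟩
  bit (x xor y) +ℙ parity (ones (zipWith _xor_ t u))
    ≡⟨ cong₂ _+ℙ_ (bit-xor x y) (parity-ones-zipWith-xor t u) ⟩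
  (bit x +ℙ bit y) +ℙ (parity (ones t) +ℙ parity (ones u))
    ≡⟨ interchange (bit x) (bit y) (parity (ones t)) (parity (ones u)) ⟩
  (bit x +ℙ parity (ones t)) +ℙ (bit y +ℙ parity (ones u))
    ≡⟨ sym (cong₂ _+ℙ_ (parity-ones-∷ x t) (parity-ones-∷ y u)) ⟩
  parity (ones (x ∷ t)) +ℙ parity (ones (y ∷ u)) ∎
  where
  open ≡-Reasoning
  open CommutativeSemigroupProperties +ℙ-commutativeSemigroup using (interchange)
  bit : Bool → Parity
  bit b = parity (ones (b ∷ []))
  parity-ones-∷ : ∀ {k} b (w : Vec Bool k) → parity (ones (b ∷ w)) ≡ bit b +ℙ parity (ones w)
  parity-ones-∷ b w = trans (cong parity (ones-∷ b w)) (+-homo-+ (ones (b ∷ [])) (ones w))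
  bit-xor : ∀ a b → bit (a xor b) ≡ bit a +ℙ bit b
  bit-xor false _     = refl
  bit-xor true  false = refl
  bit-xor true  true  = refl

parity-ones-xor3 : ∀ {j} (t u v : Vec Bool j) →
  parity (ones (pointwise xor3 t u v)) ≡ parity (ones t) +ℙ parity (ones u) +ℙ parity (ones v)
parity-ones-xor3 t u v = begin
  parity (ones (pointwise xor3 t u v))
    ≡⟨ cong (parity ∘ ones) (sym (xor3Vec≡pointwise-xor3 t u v)) ⟩
  parity (ones (zipWith _xor_ (zipWith _xor_ t u) v))
    ≡⟨ parity-ones-zipWith-xor (zipWith _xor_ t u) v ⟩
  parity (ones (zipWith _xor_ t u)) +ℙ parity (ones v)
    ≡⟨ cong (_+ℙ parity (ones v)) (parity-ones-zipWith-xor t u) ⟩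
  parity (ones t) +ℙ parity (ones u) +ℙ parity (ones v) ∎
  where open ≡-Reasoning

parity-class-closedUnder-xor3 : ∀ {j} p → ClosedUnder xor3 (λ (t : Vec Bool j) → parity (ones t) ≡ p)
parity-class-closedUnder-xor3 p t u v pt pu pv = begin
  parity (ones (pointwise xor3 t u v))                   ≡⟨ parity-ones-xor3 t u v ⟩
  parity (ones t) +ℙ parity (ones u) +ℙ parity (ones v)  ≡⟨ cong₂ _+ℙ_ (cong₂ _+ℙ_ pt pu) pv ⟩
  p +ℙ p +ℙ p                                            ≡⟨ cong (_+ℙ p) (p+p≡0ℙ p) ⟩
  p                                                      ∎
  where open ≡-Reasoning

xor3-idem : ∀ b → xor3 b b b ≡ b
xor3-idem false = refl
xor3-idem true  = refl

module XorGadgets {j} {S : Subset (suc j)} (closed : ClosedUnder xor3 R[ S ]) where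
  open Padding {xor3} xor3-idem

  grow₂ : ∀ {n} → 3 + n ≤ j → 1 + n ∈ₙ S → 3 + n ∈ₙ S
  grow₂ le w = weight-transfer closed (true ∷ false ∷ false ∷ []) (false ∷ true ∷ false ∷ [])
                 (false ∷ false ∷ true ∷ []) true true true le w w w

  shrink₂ : ∀ {n} → 3 + n ≤ j → 2 + n ∈ₙ S → n ∈ₙ S
  shrink₂ le w = weight-transfer closed (true ∷ true ∷ false ∷ []) (false ∷ true ∷ true ∷ [])
                   (true ∷ false ∷ true ∷ []) true true true le w w w

  grow₂-with-next : ∀ {n} → 2 + n ≤ j → n ∈ₙ S → 1 + n ∈ₙ S → 2 + n ∈ₙ S
  grow₂-with-next le w w₊ = weight-transfer closed (false ∷ false ∷ []) (true ∷ false ∷ [])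
                              (false ∷ true ∷ []) true true true le w w₊ w₊

  shrink₂-with-next : ∀ {n} → 2 + n ≤ j → 2 + n ∈ₙ S → 1 + n ∈ₙ S → n ∈ₙ S
  shrink₂-with-next le w w₊ = weight-transfer closed (true ∷ true ∷ []) (false ∷ true ∷ [])
                                (true ∷ false ∷ []) true true true le w w₊ w₊

module XorWeights {j} {S : Subset (suc j)} (closed : ClosedUnder xor3 R[ S ]) where
  open XorGadgets closed
  open Ladder {_∈ₙ S} 2

  SameParityAs : ℕ → Set
  SameParityAs k = ∀ {n} → n ≤ j → parity n ≡ parity k → n ∈ₙ S

  class-of-interior : ∀ {k} → 1 ≤ k → k < j → k ∈ₙ S → SameParityAs k
  class-of-interior {k} 1≤k k<j k∈S {n} n≤j pn≡pk with ≤-total k n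
  ... | inj₁ k≤n = let q , eq = ≤∧same-parity⇒steps₂ k≤n (sym pn≡pk) in ascend step k∈S q eq n≤j
    where
    step : ∀ {i} → k ≤ i → 2 + i ≤ j → i ∈ₙ S → 2 + i ∈ₙ S
    step k≤i with ≤-trans 1≤k k≤i
    ... | s≤s _ = grow₂
  ... | inj₂ n≤k = let q , eq = ≤∧same-parity⇒steps₂ n≤k pn≡pk in descend step q eq ≤-refl k∈S
    where
    step : ∀ {i} → 2 + i ≤ k → 2 + i ∈ₙ S → i ∈ₙ S
    step 2+i≤k = shrink₂ (≤-trans (s≤s 2+i≤k) k<j)

  class-of-0 : 0 ∈ₙ S → 1 ∈ₙ S → SameParityAs 0
  class-of-0 w₀ w₁ n≤j pn≡0ℙ =
    let q , eq = ≤∧same-parity⇒steps₂ z≤n (sym pn≡0ℙ) in ascend step w₀ q eq n≤j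
    where
    step : ∀ {i} → 0 ≤ i → 2 + i ≤ j → i ∈ₙ S → 2 + i ∈ₙ S
    step {0}     _ le w = grow₂-with-next le w w₁
    step {suc _} _ le w = grow₂ le w

  class-of-top : j ∈ₙ S → pred j ∈ₙ S → SameParityAs j
  class-of-top wⱼ w₋ n≤j pn≡pj =
    let q , eq = ≤∧same-parity⇒steps₂ n≤j pn≡pj in descend step q eq ≤-refl wⱼ
    where
    step : ∀ {i} → 2 + i ≤ j → 2 + i ∈ₙ S → i ∈ₙ S
    step 2+i≤j with m≤n⇒m<n∨m≡n 2+i≤j
    ... | inj₁ 3+i≤j = shrink₂ 3+i≤j
    ... | inj₂ 2+i≡j = λ w → shrink₂-with-next 2+i≤j w (subst (_∈ₙ S) (sym (cong pred 2+i≡j)) w₋)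

≤⇒≡0∨interior∨≡ : ∀ {n j} → n ≤ j → n ≡ 0 ⊎ (1 ≤ n × n < j) ⊎ n ≡ j
≤⇒≡0∨interior∨≡ {0}     _   = inj₁ refl
≤⇒≡0∨interior∨≡ {suc _} n≤j with m≤n⇒m<n∨m≡n n≤j
... | inj₁ n<j = inj₂ (inj₁ (s≤s z≤n , n<j))
... | inj₂ n≡j = inj₂ (inj₂ n≡j)

parity-class⇒affineWeightSet : ∀ {j} {S : Subset (suc j)} p →
  (∀ s → s ∈ S ⇔ parity (toℕ s) ≡ p) → AffineWeightSet j S
parity-class⇒affineWeightSet 0ℙ spec =
  inj₂ (inj₂ (inj₁ λ s → ⇔-sym (even⇔parity≡0ℙ (toℕ s)) ⇔-∘ spec s))
parity-class⇒affineWeightSet 1ℙ spec =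
  inj₂ (inj₂ (inj₂ λ s → ⇔-sym (odd⇔parity≡1ℙ (toℕ s)) ⇔-∘ spec s))

module XorClassification {j} {S : Subset (suc j)} (closed : ClosedUnder xor3 R[ S ]) where
  open XorWeights closed

  class-of-member : ∀ {k q} → 1 ≤ k → k < j → k ∈ₙ S → q ∈ₙ S → parity q ≢ parity k →
                    SameParityAs q
  class-of-member 1≤k k<j wₖ w pq≢pk with ≤⇒≡0∨interior∨≡ (∈ₙ⇒≤ w)
  ... | inj₁ refl =
    class-of-0 w (class-of-interior 1≤k k<j wₖ 1≤j (≢⇒parity-suc≡ {0} pq≢pk))
    where 1≤j = ≤-trans 1≤k (<⇒≤ k<j)
  ... | inj₂ (inj₁ (1≤q , q<j)) = class-of-interior 1≤q q<j w
  ... | inj₂ (inj₂ refl) =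
    class-of-top w (class-of-interior 1≤k k<j wₖ pred[n]≤n (≢⇒parity-pred≡ 1≤j pq≢pk))
    where 1≤j = ≤-trans 1≤k (<⇒≤ k<j)

  classify : AffineWeightSet j S
  classify with any? (λ s → (s ∈? S) ×-dec (1 ≤? toℕ s) ×-dec (suc (toℕ s) ≤? j))
  ... | no ¬interior = inj₂ (inj₁ endpoint)
    where
    endpoint : ∀ s → s ∈ S → toℕ s ≡ 0 ⊎ toℕ s ≡ j
    endpoint s s∈S with ≤⇒≡0∨interior∨≡ (toℕ≤pred[n] s)
    ... | inj₁ ≡0              = inj₁ ≡0
    ... | inj₂ (inj₁ interior) = ⊥-elim (¬interior (s , s∈S , interior))
    ... | inj₂ (inj₂ ≡j)       = inj₂ ≡j
  ... | yes (k , k∈S , 1≤k , k<j)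
    with any? (λ s → (s ∈? S) ×-dec ¬? (parity (toℕ s) ℙ≟ parity (toℕ k)))
  ...   | no ¬other =
    parity-class⇒affineWeightSet (parity (toℕ k)) (∈⇔-from-weights sound complete)
    where
    sound : ∀ {n} → n ∈ₙ S → parity n ≡ parity (toℕ k)
    sound (s , s∈S , refl) with parity (toℕ s) ℙ≟ parity (toℕ k)
    ... | yes ps≡pk = ps≡pk
    ... | no  ps≢pk = ⊥-elim (¬other (s , s∈S , ps≢pk))
    complete : ∀ {n} → n ≤ j → parity n ≡ parity (toℕ k) → n ∈ₙ S
    complete = class-of-interior 1≤k k<j (∈⇒∈ₙ k∈S)
  ...   | yes (q , q∈S , pq≢pk) = inj₁ λ s → ∈ₙ⇒∈ (all (toℕ≤pred[n] s))
    where
    all : ∀ {n} → n ≤ j → n ∈ₙ S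
    all {n} n≤j with parity-two-valued pq≢pk (parity n)
    ... | inj₁ pn≡pq = class-of-member 1≤k k<j (∈⇒∈ₙ k∈S) (∈⇒∈ₙ q∈S) pq≢pk n≤j pn≡pq
    ... | inj₂ pn≡pk = class-of-interior 1≤k k<j (∈⇒∈ₙ k∈S) n≤j pn≡pk

weightSet⇒closedUnder-xor3 : ∀ {j} {S : Subset (suc j)} → AffineWeightSet j S → ClosedUnder xor3 R[ S ]
weightSet⇒closedUnder-xor3 (inj₁ full) = closedUnder-total (R[full]-total full)
weightSet⇒closedUnder-xor3 (inj₂ (inj₁ ⊆0j)) = closedUnder-constant xor3-idem (R[⊆0j]-constant ⊆0j)
weightSet⇒closedUnder-xor3 (inj₂ (inj₂ (inj₁ S≡even))) =
  closedUnder-resp-⇔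
    (λ t → ⇔-sym (∈ₙ⇔-from-∈⇔ {Q = IsEven} S≡even (ones≤length t)) ⇔-∘ ⇔-sym (even⇔parity≡0ℙ (ones t)))
    (parity-class-closedUnder-xor3 0ℙ)
weightSet⇒closedUnder-xor3 (inj₂ (inj₂ (inj₂ S≡odd))) =
  closedUnder-resp-⇔
    (λ t → ⇔-sym (∈ₙ⇔-from-∈⇔ {Q = IsOdd} S≡odd (ones≤length t)) ⇔-∘ ⇔-sym (odd⇔parity≡1ℙ (ones t)))
    (parity-class-closedUnder-xor3 1ℙ)

affine⇔weightSet : ∀ j (S : Subset (suc j)) → Affine (R[_] {j} S) ⇔ AffineWeightSet j S
affine⇔weightSet j S =
  mk⇔ (XorClassification.classify ∘ to affine⇔closedUnder-xor3)
      (from affine⇔closedUnder-xor3 ∘ weightSet⇒closedUnder-xor3)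

-- Singletons

SingletonCase : ∀ j → Fin (suc j) → Set
SingletonCase j i = toℕ i ≡ 0 ⊎ toℕ i ≡ j ⊎ (toℕ i ≡ 1 × j ≡ 2)

∈ₙ⁅⁆⇔ : ∀ {j} {i : Fin (suc j)} {n} → n ∈ₙ ⁅ i ⁆ ⇔ toℕ i ≡ n
∈ₙ⁅⁆⇔ {i = i} = mk⇔ (λ { (s , s∈⁅i⁆ , refl) → cong toℕ (sym (x∈⁅y⁆⇒x≡y i s∈⁅i⁆)) })
                    (λ { refl → i , x∈⁅x⁆ i , refl })

⁅⁆-member : ∀ {j} {i : Fin (suc j)} {Q : ℕ → Set} → (∀ s → s ∈ ⁅ i ⁆ ⇔ Q (toℕ s)) →
            ∀ {n} → n ≤ j → Q n → toℕ i ≡ n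
⁅⁆-member spec n≤j q = to ∈ₙ⁅⁆⇔ (from (∈ₙ⇔-from-∈⇔ spec n≤j) q)

⁅⁆⊆0j : ∀ {j} {i : Fin (suc j)} → toℕ i ≡ 0 ⊎ toℕ i ≡ j → ∀ s → s ∈ ⁅ i ⁆ → toℕ s ≡ 0 ⊎ toℕ s ≡ j
⁅⁆⊆0j {i = i} i∈0j s s∈⁅i⁆ = subst (λ x → toℕ x ≡ 0 ⊎ toℕ x ≡ _) (sym (x∈⁅y⁆⇒x≡y i s∈⁅i⁆)) i∈0j

singletonCase-≤2 : ∀ {j} → j ≤ 2 → (i : Fin (suc j)) → SingletonCase j i
singletonCase-≤2 {0} _ zero             = inj₁ refl
singletonCase-≤2 {1} _ zero             = inj₁ refl
singletonCase-≤2 {1} _ (suc zero)       = inj₂ (inj₁ refl)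
singletonCase-≤2 {2} _ zero             = inj₁ refl
singletonCase-≤2 {2} _ (suc zero)       = inj₂ (inj₂ (refl , refl))
singletonCase-≤2 {2} _ (suc (suc zero)) = inj₂ (inj₁ refl)
singletonCase-≤2 {suc (suc (suc _))} (s≤s (s≤s ())) _

odd-singleton : ∀ {j} {i : Fin (suc j)} → 1 ≤ j → (∀ s → s ∈ ⁅ i ⁆ ⇔ IsOdd (toℕ s)) →
                SingletonCase j i
odd-singleton {1} _ S≡odd = inj₂ (inj₁ (⁅⁆-member {Q = IsOdd} S≡odd ≤-refl refl))
odd-singleton {2} _ S≡odd = inj₂ (inj₂ (⁅⁆-member {Q = IsOdd} S≡odd (s≤s z≤n) refl , refl))
odd-singleton {suc (suc (suc _))} _ S≡odd
  with trans (sym (⁅⁆-member {Q = IsOdd} S≡odd (s≤s z≤n) refl))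
             (⁅⁆-member {Q = IsOdd} S≡odd (s≤s (s≤s (s≤s z≤n))) refl)
... | ()

bijunctive-singleton : ∀ {j} (i : Fin (suc j)) → BijunctiveWeightSet j ⁅ i ⁆ ⇔ SingletonCase j i
bijunctive-singleton {j} i = mk⇔ to′ from′
  where
  to′ : BijunctiveWeightSet j ⁅ i ⁆ → SingletonCase j i
  to′ (inj₁ full)       = inj₁ (to ∈ₙ⁅⁆⇔ (∈⇒∈ₙ (full zero)))
  to′ (inj₂ (inj₁ ⊆0j)) = map₂ inj₁ (⊆0j i (x∈⁅x⁆ i))
  to′ (inj₂ (inj₂ (inj₁ S≡01))) =
    inj₁ (⁅⁆-member {Q = λ n → n ≡ 0 ⊎ n ≡ 1} S≡01 z≤n (inj₁ refl))
  to′ (inj₂ (inj₂ (inj₂ (inj₁ S≡top)))) =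
    inj₂ (inj₁ (⁅⁆-member {Q = λ n → n ≡ j ∸ 1 ⊎ n ≡ j} S≡top ≤-refl (inj₂ refl)))
  to′ (inj₂ (inj₂ (inj₂ (inj₂ j≤2)))) = singletonCase-≤2 j≤2 i
  from′ : SingletonCase j i → BijunctiveWeightSet j ⁅ i ⁆
  from′ (inj₁ i≡0)               = inj₂ (inj₁ (⁅⁆⊆0j (inj₁ i≡0)))
  from′ (inj₂ (inj₁ i≡j))        = inj₂ (inj₁ (⁅⁆⊆0j (inj₂ i≡j)))
  from′ (inj₂ (inj₂ (_ , refl))) = inj₂ (inj₂ (inj₂ (inj₂ ≤-refl)))

affine-singleton : ∀ {j} → 1 ≤ j → (i : Fin (suc j)) → AffineWeightSet j ⁅ i ⁆ ⇔ SingletonCase j i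
affine-singleton {j} 1≤j i = mk⇔ to′ from′
  where
  to′ : AffineWeightSet j ⁅ i ⁆ → SingletonCase j i
  to′ (inj₁ full)                 = inj₁ (to ∈ₙ⁅⁆⇔ (∈⇒∈ₙ (full zero)))
  to′ (inj₂ (inj₁ ⊆0j))           = map₂ inj₁ (⊆0j i (x∈⁅x⁆ i))
  to′ (inj₂ (inj₂ (inj₁ S≡even))) = inj₁ (⁅⁆-member {Q = IsEven} S≡even z≤n refl)
  to′ (inj₂ (inj₂ (inj₂ S≡odd)))  = odd-singleton 1≤j S≡odd
  from′ : SingletonCase j i → AffineWeightSet j ⁅ i ⁆
  from′ (inj₁ i≡0)                 = inj₂ (inj₁ (⁅⁆⊆0j (inj₁ i≡0)))
  from′ (inj₂ (inj₁ i≡j))          = inj₂ (inj₁ (⁅⁆⊆0j (inj₂ i≡j)))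
  from′ (inj₂ (inj₂ (i≡1 , refl))) = inj₂ (inj₂ (inj₂ (∈⇔-from-weights sound complete)))
    where
    sound : ∀ {n} → n ∈ₙ ⁅ i ⁆ → IsOdd n
    sound w with trans (sym (to ∈ₙ⁅⁆⇔ w)) i≡1
    ... | refl = refl
    complete : ∀ {n} → n ≤ 2 → IsOdd n → n ∈ₙ ⁅ i ⁆
    complete {0}                 _               ()
    complete {1}                 _               _  = from ∈ₙ⁅⁆⇔ i≡1
    complete {2}                 _               ()
    complete {suc (suc (suc _))} (s≤s (s≤s ())) _

lemma3p2 : (j : ℕ) → 1 ≤ j →
    ((S : Subset (suc j)) →
      (Bijunctive (R[_] {j} S) ⇔
        ((∀ (s : Fin (suc j)) → s ∈ S)
         ⊎ (∀ (s : Fin (suc j)) → s ∈ S → (toℕ s ≡ 0 ⊎ toℕ s ≡ j))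
         ⊎ (∀ (s : Fin (suc j)) → (s ∈ S ⇔ (toℕ s ≡ 0 ⊎ toℕ s ≡ 1)))
         ⊎ (∀ (s : Fin (suc j)) → (s ∈ S ⇔ (toℕ s ≡ j ∸ 1 ⊎ toℕ s ≡ j)))
         ⊎ j ≤ 2))
      × (Affine (R[_] {j} S) ⇔
        ((∀ (s : Fin (suc j)) → s ∈ S)
         ⊎ (∀ (s : Fin (suc j)) → s ∈ S → (toℕ s ≡ 0 ⊎ toℕ s ≡ j))
         ⊎ (∀ (s : Fin (suc j)) → (s ∈ S ⇔ IsEven (toℕ s)))
         ⊎ (∀ (s : Fin (suc j)) → (s ∈ S ⇔ IsOdd (toℕ s))))))
    × ((i : Fin (suc j)) →
      (Bijunctive (R[_] {j} ⁅ i ⁆) ⇔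
        (toℕ i ≡ 0 ⊎ toℕ i ≡ j ⊎ (toℕ i ≡ 1 × j ≡ 2)))
      × (Affine (R[_] {j} ⁅ i ⁆) ⇔
        (toℕ i ≡ 0 ⊎ toℕ i ≡ j ⊎ (toℕ i ≡ 1 × j ≡ 2))))
lemma3p2 j 1≤j =
  (λ S → bijunctive⇔weightSet j S , affine⇔weightSet j S) ,
  (λ i → bijunctive-singleton i ⇔-∘ bijunctive⇔weightSet j ⁅ i ⁆ ,
         affine-singleton 1≤j i ⇔-∘ affine⇔weightSet j ⁅ i ⁆)
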